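{- $Z_{(2)}(Q_3) = 6$, where $Q_3$ is the $3$-dimensional hypercube.
   Context: $Q_3$ is the graph whose vertices are binary strings of length $3$, two being adjacent iff they differ in exactly one coordinate. Let $G=(V,E)$ be a finite simple graph. Color-change rule (zero forcing): given a set of colored vertices, a colored vertex with exactly one uncolored neighbor colors ("forces") that neighbor. Leaks: for a set $L\subseteq V$, placing a leak on each $v\in L$ means attaching to $v$ one new pendant vertex (adjacent only to $v$) which is never initially colored; consequently no vertex of $L$ can ever force a vertex of $V$. A set $S\subseteq V$ is an $\ell$-forcing set if for every $L\subseteq V$ with $|L|\le \ell$, starting with exactly the vertices of $S$ colored and repeatedly applying the color-change rule in the graph with leaks on $L$, every vertex of $V$ eventually becomes colored. $Z_{(\ell)}(G)$ is the minimum size of an $\ell$-forcing set. -}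

module Defs where

open import Data.Nat using (ℕ; zero; suc; _+_; _≤_)
open import Data.Bool using (Bool; true; false; if_then_else_)
open import Data.Vec using (Vec; []; _∷_)
open import Data.List using (List; length)
open import Data.List.Membership.Propositional using (_∈_)
open import Data.List.Relation.Unary.Unique.Propositional using (Unique)
open import Data.Product using (Σ; _×_)
open import Data.Sum using (_⊎_; inj₁; inj₂)
open import Data.Empty using (⊥)
open import Relation.Binary.PropositionalEquality using (_≡_)

record Graph : Set₁ where
  field
    V   : Set
    _~_ : V → V → Set

-- Closure of the colour-change rule: a colored vertex v all of whose
-- neighbours other than x are colored forces x.
data Colored {V : Set} (_~_ : V → V → Set) (S : V → Set) : V → Set where
  initial : ∀ {x} → S x → Colored _~_ S x
  force   : ∀ {x} (v : V) → Colored _~_ S v → v ~ x →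
            (∀ w → v ~ w → w ≡ x ⊎ Colored _~_ S w) → Colored _~_ S x

-- G with a leak on each vertex of L: one new pendant vertex per v ∈ L.
-- (L is a duplicate-free list, so each v ∈ L has exactly one pendant.)
module _ (G : Graph) where
  open Graph G

  LeakV : List V → Set
  LeakV L = V ⊎ Σ V (λ v → v ∈ L)

  leakAdj : (L : List V) → LeakV L → LeakV L → Set
  leakAdj L (inj₁ a) (inj₁ b) = a ~ b
  leakAdj L (inj₁ a) (inj₂ (b Data.Product., _)) = a ≡ b
  leakAdj L (inj₂ (a Data.Product., _)) (inj₁ b) = a ≡ b
  leakAdj L (inj₂ _) (inj₂ _) = ⊥

  initS : (S L : List V) → LeakV L → Set
  initS S L (inj₁ v) = v ∈ S
  initS S L (inj₂ _) = ⊥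

  IsLForcing : ℕ → List V → Set
  IsLForcing ℓ S = (L : List V) → Unique L → length L ≤ ℓ →
                   (v : V) → Colored (leakAdj L) (initS S L) (inj₁ v)

  Zℓ≡ : ℕ → ℕ → Set
  Zℓ≡ ℓ k = (Σ (List V) λ S → Unique S × length S ≡ k × IsLForcing ℓ S)
          × ((S : List V) → Unique S → IsLForcing ℓ S → k ≤ length S)

hamming : ∀ {d} → Vec Bool d → Vec Bool d → ℕ
hamming [] [] = 0
hamming (a ∷ xs) (b ∷ ys) = (if Data.Bool._xor_ a b then 1 else 0) + hamming xs ys

Q : ℕ → Graph
Q d = record { V = Vec Bool d ; _~_ = λ x y → hamming x y ≡ 1 }

module Submission where

-- The six vertices other than 000 and 111 form a 2-forcing set: at most two leaks
-- cannot cover the three neighbours of a corner, and an unleaked neighbour has all its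
-- other neighbours coloured, so it forces the corner.
--
-- Conversely, if |S| ≤ 5 then three vertices lie outside S; two of them have the same
-- parity, hence differ in exactly two coordinates. Leaking the two vertices obtained
-- from this pair by flipping the third coordinate turns the pair into a fort: every
-- other vertex adjacent to one of them is adjacent to both. A set disjoint from a fort
-- never colours it.

open import Defs
open import Algebra.Bundles using (CommutativeRing)
open import Data.Bool using (Bool; true; false; not; _xor_; if_then_else_)
open import Data.Bool.Properties
  using (not-¬; not-involutive; xor-same; xor-inverseʳ; xor-∧-commutativeRing)
  renaming (_≟_ to _≟ᴮ_)
open import Algebra.Properties.CommutativeSemigroup
  (CommutativeRing.+-commutativeSemigroup xor-∧-commutativeRing)
  using (interchange)
open import Data.Empty using (⊥-elim)
open import Function.Base using (_∘_)
open import Data.Fin using (Fin; zero; suc; _≟_)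
open import Data.Fin.Properties using (all?; any?; suc-injective)
open import Data.List using (List; []; _∷_; _++_; length; tabulate)
open import Data.List.Membership.Propositional using (_∈_; _∉_; find)
open import Data.List.Membership.Propositional.Properties
  using (∈-∃++; ∈-++⁻; ∈-++⁺ˡ; ∈-++⁺ʳ; ∈-tabulate⁻)
open import Data.List.Properties using (length-++)
open import Data.List.Relation.Binary.Subset.Propositional using (_⊆_)
open import Data.List.Relation.Unary.All as All using (All; []; _∷_)
open import Data.List.Relation.Unary.All.Properties using (¬All⇒Any¬)
open import Data.List.Relation.Unary.AllPairs using ([]; _∷_)
open import Data.List.Relation.Unary.Any using (here; there)
open import Data.List.Relation.Unary.Unique.Propositional using (Unique)
open import Data.List.Relation.Unary.Unique.Propositional.Properties using (tabulate⁺)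
open import Data.Nat using (ℕ; zero; suc; _+_; _≤_; _<_; z≤n; s≤s; _≤?_)
open import Data.Nat.Properties
  using (≤-refl; ≰⇒>; <⇒≤; <⇒≱; m≤n⇒m≤1+n; +-suc; module ≤-Reasoning)
  renaming (suc-injective to ℕ-suc-injective)
open import Data.Product using (∃-syntax; _×_; _,_; proj₁; proj₂)
open import Data.Sum using (_⊎_; inj₁; inj₂)
open import Data.Sum.Properties using (inj₁-injective)
open import Data.Vec using (Vec; []; _∷_; lookup; _[_]%=_)
open import Data.Vec.Properties
  using ( ≡-dec; updateAt-updateAt; updateAt-id-local; updateAt-commutes
        ; lookup∘updateAt; lookup∘updateAt′)
open import Relation.Binary.Definitions using (DecidableEquality)
open import Relation.Binary.PropositionalEquality
  using (_≡_; _≢_; refl; sym; trans; cong; subst; ≢-sym; module ≡-Reasoning)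
open import Relation.Nullary using (¬_; yes; no; contradiction)
open import Relation.Nullary.Decidable using (toWitness; ¬?; _→-dec_)

IsFort : {V : Set} → (V → V → Set) → (V → Set) → Set
IsFort _~_ F = ∀ v x → ¬ F v → F x → v ~ x → ∃[ w ] (w ≢ x × v ~ w × F w)

fort-uncolored : {V : Set} {_~_ : V → V → Set} {S F : V → Set} → IsFort _~_ F →
                 (∀ {x} → S x → ¬ F x) → ∀ {x} → Colored _~_ S x → ¬ F x
fort-uncolored fort S∩F=∅ (initial Sx) = S∩F=∅ Sx
fort-uncolored fort S∩F=∅ (force v colored-v v~x others) Fx
  with fort v _ (fort-uncolored fort S∩F=∅ colored-v) Fx v~x
... | w , w≢x , v~w , Fw with others w v~w
...   | inj₁ w≡x = w≢x w≡x
...   | inj₂ colored-w = fort-uncolored fort S∩F=∅ colored-w Fw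

module _ (G : Graph) where
  open Graph G

  IsLeakyFort : List V → (V → Set) → Set
  IsLeakyFort L F = ∀ v x → ¬ F v → F x → v ~ x → v ∈ L ⊎ ∃[ w ] (w ≢ x × v ~ w × F w)

  leaky-fort-uncolored : ∀ {S L F} → IsLeakyFort L F → (∀ {x} → x ∈ S → ¬ F x) →
                         ∀ {x} → F x → ¬ Colored (leakAdj G L) (initS G S L) (inj₁ x)
  leaky-fort-uncolored {S} {L} {F} leaky-fort S∩F=∅ Fx colored =
    fort-uncolored fort S∩F⁺=∅ colored Fx
    where
    -- Pendants join the fort so that a leak next to F always has a second neighbour in it.
    F⁺ : LeakV G L → Set
    F⁺ (inj₁ v)       = F v
    F⁺ (inj₂ (v , _)) = F v ⊎ ∃[ x ] (F x × v ~ x)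

    S∩F⁺=∅ : ∀ {x} → initS G S L x → ¬ F⁺ x
    S∩F⁺=∅ {inj₁ _} = S∩F=∅
    S∩F⁺=∅ {inj₂ _} ()

    fort : IsFort (leakAdj G L) F⁺
    fort (inj₁ v) (inj₁ x) ¬Fv Fx v~x with leaky-fort v x ¬Fv Fx v~x
    ... | inj₁ v∈L = inj₂ (v , v∈L) , (λ ()) , refl , inj₂ (x , Fx , v~x)
    ... | inj₂ (w , w≢x , v~w , Fw) = inj₁ w , (λ eq → w≢x (inj₁-injective eq)) , v~w , Fw
    fort (inj₁ v) (inj₂ _) ¬Fv (inj₁ Fv) refl = ⊥-elim (¬Fv Fv)
    fort (inj₁ v) (inj₂ _) ¬Fv (inj₂ (x , Fx , v~x)) refl = inj₁ x , (λ ()) , v~x , Fx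
    fort (inj₂ _) (inj₁ _) ¬F⁺v Fv refl = ⊥-elim (¬F⁺v (inj₁ Fv))
    fort (inj₂ _) (inj₂ _) _ _ ()

  forced-by-unleaked : ∀ {S L v x} → v ∈ S → v ∉ L → v ~ x → (∀ {w} → v ~ w → w ≡ x ⊎ w ∈ S) →
                       Colored (leakAdj G L) (initS G S L) (inj₁ x)
  forced-by-unleaked {S} {L} {v} {x} v∈S v∉L v~x others =
    force (inj₁ v) (initial v∈S) v~x others′
    where
    others′ : ∀ w → leakAdj G L (inj₁ v) w → w ≡ inj₁ x ⊎ Colored (leakAdj G L) (initS G S L) w
    others′ (inj₁ w) v~w with others v~w
    ... | inj₁ w≡x = inj₁ (cong inj₁ w≡x)
    ... | inj₂ w∈S = inj₂ (initial w∈S)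
    others′ (inj₂ (_ , v∈L)) refl = ⊥-elim (v∉L v∈L)

module _ {A : Set} where

  ∈-skip-≢ : ∀ {x y} (us : List A) {vs} → y ≢ x → y ∈ us ++ x ∷ vs → y ∈ us ++ vs
  ∈-skip-≢ us y≢x y∈ with ∈-++⁻ us y∈
  ... | inj₁ y∈us = ∈-++⁺ˡ y∈us
  ... | inj₂ (here y≡x) = contradiction y≡x y≢x
  ... | inj₂ (there y∈vs) = ∈-++⁺ʳ us y∈vs

  Unique-⊆⇒length-≤ : ∀ {xs ys : List A} → Unique xs → xs ⊆ ys → length xs ≤ length ys
  Unique-⊆⇒length-≤ {[]} _ _ = z≤n
  Unique-⊆⇒length-≤ {x ∷ xs} (x≢xs ∷ xs-unique) xs⊆ys with ∈-∃++ (xs⊆ys (here refl))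
  ... | us , vs , refl = begin
    suc (length xs)          ≤⟨ s≤s (Unique-⊆⇒length-≤ xs-unique xs⊆us++vs) ⟩
    suc (length (us ++ vs))  ≡⟨ cong suc (length-++ us) ⟩
    suc (length us + length vs) ≡⟨ +-suc (length us) (length vs) ⟨
    length us + length (x ∷ vs) ≡⟨ length-++ us ⟨
    length (us ++ x ∷ vs)    ∎
    where
    open ≤-Reasoning
    xs⊆us++vs : xs ⊆ us ++ vs
    xs⊆us++vs y∈xs = ∈-skip-≢ us (λ y≡x → All.lookup x≢xs y∈xs (sym y≡x)) (xs⊆ys (there y∈xs))

  module _ (_≟ᴬ_ : DecidableEquality A) where
    open import Data.List.Membership.DecPropositional _≟ᴬ_ using (_∈?_)

    missing-element : ∀ {xs ys : List A} → Unique xs → length ys < length xs →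
                      ∃[ x ] (x ∈ xs × x ∉ ys)
    missing-element {xs} {ys} xs-unique ys<xs with All.all? (_∈? ys) xs
    ... | yes xs⊆ys = contradiction (Unique-⊆⇒length-≤ xs-unique (All.lookup xs⊆ys)) (<⇒≱ ys<xs)
    ... | no xs⊈ys = find (¬All⇒Any¬ (_∈? ys) xs xs⊈ys)

module _ {d : ℕ} where

  flip : Fin d → Vec Bool d → Vec Bool d
  flip i u = u [ i ]%= not

  flip-involutive : ∀ i (u : Vec Bool d) → flip i (flip i u) ≡ u
  flip-involutive i u = trans (updateAt-updateAt i u) (updateAt-id-local i u (not-involutive _))

  flip-comm : ∀ {i j} → i ≢ j → (u : Vec Bool d) → flip i (flip j u) ≡ flip j (flip i u)
  flip-comm {i} {j} i≢j u = updateAt-commutes i j i≢j u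

  flip-injective : ∀ i {u w : Vec Bool d} → flip i u ≡ flip i w → u ≡ w
  flip-injective i {u} {w} eq = begin
    u                  ≡⟨ flip-involutive i u ⟨
    flip i (flip i u)  ≡⟨ cong (flip i) eq ⟩
    flip i (flip i w)  ≡⟨ flip-involutive i w ⟩
    w                  ∎
    where open ≡-Reasoning

  flip-moves : ∀ i {u w : Vec Bool d} → lookup w i ≡ lookup u i → flip i u ≢ w
  flip-moves i {u} {w} same flipped = not-¬ refl (begin
    lookup u i           ≡⟨ same ⟨
    lookup w i           ≡⟨ cong (λ z → lookup z i) flipped ⟨
    lookup (flip i u) i  ≡⟨ lookup∘updateAt i u ⟩
    not (lookup u i)     ∎)
    where open ≡-Reasoning

  flip-injectiveˡ : ∀ (u : Vec Bool d) {i j} → flip i u ≡ flip j u → i ≡ j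
  flip-injectiveˡ u {i} {j} eq with i ≟ j
  ... | yes i≡j = i≡j
  ... | no i≢j = contradiction eq (flip-moves i (lookup∘updateAt′ i j i≢j u))

  double-flip-≢ : ∀ {i j} → i ≢ j → (u : Vec Bool d) → flip i (flip j u) ≢ u
  double-flip-≢ {i} {j} i≢j u = flip-moves i (sym (lookup∘updateAt′ i j i≢j u))

hamming-self : ∀ {d} (u : Vec Bool d) → hamming u u ≡ 0
hamming-self [] = refl
hamming-self (a ∷ u) rewrite xor-same a = hamming-self u

hamming-flip : ∀ {d} i (u : Vec Bool d) → hamming u (flip i u) ≡ 1
hamming-flip zero (a ∷ u) rewrite xor-inverseʳ a = cong suc (hamming-self u)
hamming-flip (suc i) (a ∷ u) rewrite xor-same a = hamming-flip i u

hamming≡0⇒≡ : ∀ {d} (u w : Vec Bool d) → hamming u w ≡ 0 → u ≡ w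
hamming≡0⇒≡ [] [] _ = refl
hamming≡0⇒≡ (false ∷ u) (false ∷ w) h = cong (false ∷_) (hamming≡0⇒≡ u w h)
hamming≡0⇒≡ (true ∷ u) (true ∷ w) h = cong (true ∷_) (hamming≡0⇒≡ u w h)

hamming≡1⇒flip : ∀ {d} (u w : Vec Bool d) → hamming u w ≡ 1 → ∃[ i ] w ≡ flip i u
hamming≡1⇒flip [] [] ()
hamming≡1⇒flip (false ∷ u) (false ∷ w) h with hamming≡1⇒flip u w h
... | i , refl = suc i , refl
hamming≡1⇒flip (true ∷ u) (true ∷ w) h with hamming≡1⇒flip u w h
... | i , refl = suc i , refl
hamming≡1⇒flip (false ∷ u) (true ∷ w) h =
  zero , cong (true ∷_) (sym (hamming≡0⇒≡ u w (ℕ-suc-injective h)))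
hamming≡1⇒flip (true ∷ u) (false ∷ w) h =
  zero , cong (false ∷_) (sym (hamming≡0⇒≡ u w (ℕ-suc-injective h)))

hamming≡2⇒double-flip : ∀ {d} (u w : Vec Bool d) → hamming u w ≡ 2 →
                        ∃[ i ] ∃[ j ] (i ≢ j × w ≡ flip i (flip j u))
hamming≡2⇒double-flip [] [] ()
hamming≡2⇒double-flip (false ∷ u) (false ∷ w) h with hamming≡2⇒double-flip u w h
... | i , j , i≢j , refl = suc i , suc j , (λ eq → i≢j (suc-injective eq)) , refl
hamming≡2⇒double-flip (true ∷ u) (true ∷ w) h with hamming≡2⇒double-flip u w h
... | i , j , i≢j , refl = suc i , suc j , (λ eq → i≢j (suc-injective eq)) , refl
hamming≡2⇒double-flip (false ∷ u) (true ∷ w) h with hamming≡1⇒flip u w (ℕ-suc-injective h)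
... | j , refl = zero , suc j , (λ ()) , refl
hamming≡2⇒double-flip (true ∷ u) (false ∷ w) h with hamming≡1⇒flip u w (ℕ-suc-injective h)
... | j , refl = zero , suc j , (λ ()) , refl

hamming≤dim : ∀ {d} (u w : Vec Bool d) → hamming u w ≤ d
hamming≤dim [] [] = z≤n
hamming≤dim (a ∷ u) (b ∷ w) with a xor b
... | true  = s≤s (hamming≤dim u w)
... | false = m≤n⇒m≤1+n (hamming≤dim u w)

odd : ℕ → Bool
odd zero    = false
odd (suc n) = not (odd n)

parity : ∀ {d} → Vec Bool d → Bool
parity []      = false
parity (a ∷ u) = a xor parity u

odd-hamming : ∀ {d} (u w : Vec Bool d) → odd (hamming u w) ≡ parity u xor parity w
odd-hamming [] [] = refl
odd-hamming (a ∷ u) (b ∷ w) = begin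
  odd ((if a xor b then 1 else 0) + hamming u w)  ≡⟨ odd-bit+ (a xor b) ⟩
  (a xor b) xor odd (hamming u w)                  ≡⟨ cong ((a xor b) xor_) (odd-hamming u w) ⟩
  (a xor b) xor (parity u xor parity w)            ≡⟨ interchange a b (parity u) (parity w) ⟩
  (a xor parity u) xor (b xor parity w)            ∎
  where
  open ≡-Reasoning
  odd-bit+ : ∀ c → odd ((if c then 1 else 0) + hamming u w) ≡ c xor odd (hamming u w)
  odd-bit+ true  = refl
  odd-bit+ false = refl

unleaked-neighbour : ∀ {d} {L : List (Vec Bool d)} {x v : Vec Bool d} {i j} → i ≢ j →
                     (∀ m → m ≢ i → m ≢ j → flip m x ∈ L) →
                     hamming v x ≡ 1 → v ∈ L ⊎ hamming v (flip i (flip j x)) ≡ 1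
unleaked-neighbour {L = L} {x} {v} {i} {j} i≢j leaks v~x with hamming≡1⇒flip v x v~x
... | m , refl with m ≟ i | m ≟ j
... | yes refl | _ = inj₂ (subst (λ y → hamming v y ≡ 1) (sym (begin
  flip m (flip j (flip m v))  ≡⟨ cong (flip m) (flip-comm (≢-sym i≢j) v) ⟩
  flip m (flip m (flip j v))  ≡⟨ flip-involutive m (flip j v) ⟩
  flip j v                    ∎)) (hamming-flip j v))
  where open ≡-Reasoning
... | no _ | yes refl =
  inj₂ (subst (λ y → hamming v (flip i y) ≡ 1) (sym (flip-involutive m v)) (hamming-flip i v))
... | no m≢i | no m≢j = inj₁ (subst (_∈ L) (flip-involutive m v) (leaks m m≢i m≢j))

double-flip-fort : ∀ {d} {L : List (Vec Bool d)} {x : Vec Bool d} {i j} → i ≢ j →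
                   (∀ m → m ≢ i → m ≢ j → flip m x ∈ L × flip m (flip i (flip j x)) ∈ L) →
                   IsLeakyFort (Q d) L (λ v → v ≡ x ⊎ v ≡ flip i (flip j x))
double-flip-fort {x = x} {i} {j} i≢j leaks v _ _ (inj₁ refl) v~x
  with unleaked-neighbour i≢j (λ m m≢i m≢j → proj₁ (leaks m m≢i m≢j)) v~x
... | inj₁ v∈L = inj₁ v∈L
... | inj₂ v~y = inj₂ (flip i (flip j x) , double-flip-≢ i≢j x , v~y , inj₂ refl)
double-flip-fort {x = x} {i} {j} i≢j leaks v _ _ (inj₂ refl) v~y
  with unleaked-neighbour (≢-sym i≢j) (λ m m≢j m≢i → proj₂ (leaks m m≢i m≢j)) v~y
... | inj₁ v∈L = inj₁ v∈L
... | inj₂ v~x =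
  inj₂ (x , ≢-sym (double-flip-≢ i≢j x) , subst (λ z → hamming v z ≡ 1) back v~x , inj₁ refl)
  where
  back : flip j (flip i (flip i (flip j x))) ≡ x
  back = trans (cong (flip j) (flip-involutive i (flip j x))) (flip-involutive j x)

bool-pigeonhole : (a b c : Bool) → a ≡ b ⊎ a ≡ c ⊎ b ≡ c
bool-pigeonhole false false _     = inj₁ refl
bool-pigeonhole true  true  _     = inj₁ refl
bool-pigeonhole false true  false = inj₂ (inj₁ refl)
bool-pigeonhole true  false true  = inj₂ (inj₁ refl)
bool-pigeonhole false true  true  = inj₂ (inj₂ refl)
bool-pigeonhole true  false false = inj₂ (inj₂ refl)

nonzero-even-≤3⇒≡2 : ∀ {n} → n ≤ 3 → n ≢ 0 → odd n ≡ false → n ≡ 2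
nonzero-even-≤3⇒≡2 {0} _ 0≢0 _ = contradiction refl 0≢0
nonzero-even-≤3⇒≡2 {1} _ _ ()
nonzero-even-≤3⇒≡2 {2} _ _ _ = refl
nonzero-even-≤3⇒≡2 {3} _ _ ()
nonzero-even-≤3⇒≡2 {suc (suc (suc (suc _)))} (s≤s (s≤s (s≤s ()))) _ _

V₃ : Set
V₃ = Vec Bool 3

_≟ⱽ_ : DecidableEquality V₃
_≟ⱽ_ = ≡-dec _≟ᴮ_

open import Data.List.Membership.DecPropositional _≟ⱽ_ using (_∈?_)
open import Data.List.Relation.Unary.Unique.DecPropositional _≟ⱽ_ using (unique?)

same-parity⇒hamming≡2 : ∀ {u w : V₃} → u ≢ w → parity u ≡ parity w → hamming u w ≡ 2
same-parity⇒hamming≡2 {u} {w} u≢w same = nonzero-even-≤3⇒≡2 (hamming≤dim u w)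
  (λ h≡0 → u≢w (hamming≡0⇒≡ u w h≡0))
  (trans (odd-hamming u w) (trans (cong (_xor parity w) same) (xor-same (parity w))))

third-coordinate : ∀ {i j : Fin 3} → i ≢ j → ∃[ k ] (∀ m → m ≢ i → m ≢ j → m ≡ k)
third-coordinate {i} {j} = toWitness {a? = all? λ i → all? λ j → ¬? (i ≟ j) →-dec
  any? λ k → all? λ m → ¬? (m ≟ i) →-dec ¬? (m ≟ j) →-dec m ≟ k} _ i j

vertices : List V₃
vertices = (false ∷ false ∷ false ∷ []) ∷ (false ∷ false ∷ true ∷ []) ∷
           (false ∷ true ∷ false ∷ []) ∷ (false ∷ true ∷ true ∷ []) ∷
           (true ∷ false ∷ false ∷ []) ∷ (true ∷ false ∷ true ∷ []) ∷
           (true ∷ true ∷ false ∷ []) ∷ (true ∷ true ∷ true ∷ []) ∷ []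

vertices-unique : Unique vertices
vertices-unique = toWitness {a? = unique? vertices} _

MissesDoubleFlip : List V₃ → Set
MissesDoubleFlip S = ∃[ x ] ∃[ i ] ∃[ j ] (i ≢ j × x ∉ S × flip i (flip j x) ∉ S)

misses-same-parity-pair : ∀ {S x y} → x ∉ S → y ∉ S → x ≢ y → parity x ≡ parity y →
                          MissesDoubleFlip S
misses-same-parity-pair {x = x} {y} x∉S y∉S x≢y same
  with hamming≡2⇒double-flip x y (same-parity⇒hamming≡2 x≢y same)
... | i , j , i≢j , refl = x , i , j , i≢j , x∉S , y∉S

small-sets-miss-double-flip : ∀ {S} → 3 + length S ≤ length vertices → MissesDoubleFlip S
small-sets-miss-double-flip {S} room
  with missing-element _≟ⱽ_ {ys = S} vertices-unique (<⇒≤ (<⇒≤ room))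
... | m₁ , _ , m₁∉S with missing-element _≟ⱽ_ {ys = m₁ ∷ S} vertices-unique (<⇒≤ room)
... | m₂ , _ , m₂∉ with missing-element _≟ⱽ_ {ys = m₂ ∷ m₁ ∷ S} vertices-unique room
... | m₃ , _ , m₃∉ with bool-pigeonhole (parity m₁) (parity m₂) (parity m₃)
... | inj₁ same₁₂ =
  misses-same-parity-pair m₁∉S (m₂∉ ∘ there) (m₂∉ ∘ here ∘ sym) same₁₂
... | inj₂ (inj₁ same₁₃) =
  misses-same-parity-pair m₁∉S (m₃∉ ∘ there ∘ there) (m₃∉ ∘ there ∘ here ∘ sym) same₁₃
... | inj₂ (inj₂ same₂₃) =
  misses-same-parity-pair (m₂∉ ∘ there) (m₃∉ ∘ there ∘ there) (m₃∉ ∘ here ∘ sym) same₂₃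

double-flip-blocks : ∀ {S} → MissesDoubleFlip S → ¬ IsLForcing (Q 3) 2 S
double-flip-blocks {S} (x , i , j , i≢j , x∉S , y∉S) forcing with third-coordinate i≢j
... | k , only-k =
  leaky-fort-uncolored (Q 3) (double-flip-fort i≢j leaks) disjoint (inj₁ refl)
                       (forcing L L-unique ≤-refl x)
  where
  y : V₃
  y = flip i (flip j x)

  L : List V₃
  L = flip k x ∷ flip k y ∷ []

  leaks : ∀ m → m ≢ i → m ≢ j → flip m x ∈ L × flip m y ∈ L
  leaks m m≢i m≢j rewrite only-k m m≢i m≢j = here refl , there (here refl)

  L-unique : Unique L
  L-unique = ((λ eq → double-flip-≢ i≢j x (sym (flip-injective k eq))) ∷ []) ∷ [] ∷ []

  disjoint : ∀ {v} → v ∈ S → ¬ (v ≡ x ⊎ v ≡ y)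
  disjoint v∈S (inj₁ refl) = x∉S v∈S
  disjoint v∈S (inj₂ refl) = y∉S v∈S

corner : Bool → V₃
corner b = b ∷ b ∷ b ∷ []

S₆ : List V₃
S₆ = (true ∷ false ∷ false ∷ []) ∷ (false ∷ true ∷ false ∷ []) ∷ (false ∷ false ∷ true ∷ []) ∷
     (true ∷ true ∷ false ∷ []) ∷ (true ∷ false ∷ true ∷ []) ∷ (false ∷ true ∷ true ∷ []) ∷ []

S₆-unique : Unique S₆
S₆-unique = toWitness {a? = unique? S₆} _

corner-or-S₆ : ∀ v → (∃[ b ] v ≡ corner b) ⊎ v ∈ S₆
corner-or-S₆ (false ∷ false ∷ false ∷ []) = inj₁ (false , refl)
corner-or-S₆ (true ∷ true ∷ true ∷ [])    = inj₁ (true , refl)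
corner-or-S₆ (true ∷ false ∷ false ∷ [])  = inj₂ (here refl)
corner-or-S₆ (false ∷ true ∷ false ∷ [])  = inj₂ (there (here refl))
corner-or-S₆ (false ∷ false ∷ true ∷ [])  = inj₂ (there (there (here refl)))
corner-or-S₆ (true ∷ true ∷ false ∷ [])   = inj₂ (there (there (there (here refl))))
corner-or-S₆ (true ∷ false ∷ true ∷ [])   = inj₂ (there (there (there (there (here refl)))))
corner-or-S₆ (false ∷ true ∷ true ∷ [])   = inj₂ (there (there (there (there (there (here refl))))))

flip-corner∈S₆ : ∀ b i → flip i (corner b) ∈ S₆
flip-corner∈S₆ false = toWitness {a? = all? λ i → flip i (corner false) ∈? S₆} _
flip-corner∈S₆ true  = toWitness {a? = all? λ i → flip i (corner true) ∈? S₆} _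

double-flip-corner∈S₆ : ∀ b i j → i ≢ j → flip i (flip j (corner b)) ∈ S₆
double-flip-corner∈S₆ false =
  toWitness {a? = all? λ i → all? λ j → ¬? (i ≟ j) →-dec flip i (flip j (corner false)) ∈? S₆} _
double-flip-corner∈S₆ true =
  toWitness {a? = all? λ i → all? λ j → ¬? (i ≟ j) →-dec flip i (flip j (corner true)) ∈? S₆} _

corner-forced : ∀ {L} → length L ≤ 2 → ∀ b →
                Colored (leakAdj (Q 3) L) (initS (Q 3) S₆ L) (inj₁ (corner b))
corner-forced {L} |L|≤2 b
  with missing-element _≟ⱽ_ {xs = tabulate (λ i → flip i (corner b))}
                            (tabulate⁺ (flip-injectiveˡ (corner b))) (s≤s |L|≤2)
... | n , n∈N , n∉L with ∈-tabulate⁻ {f = λ i → flip i (corner b)} n∈N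
... | i , refl = forced-by-unleaked (Q 3) (flip-corner∈S₆ b i) n∉L n~c others
  where
  c : V₃
  c = corner b

  n~c : hamming (flip i c) c ≡ 1
  n~c = subst (λ z → hamming (flip i c) z ≡ 1) (flip-involutive i c) (hamming-flip i (flip i c))

  others : ∀ {w} → hamming (flip i c) w ≡ 1 → w ≡ c ⊎ w ∈ S₆
  others {w} n~w with hamming≡1⇒flip (flip i c) w n~w
  ... | m , refl with m ≟ i
  ... | yes refl = inj₁ (flip-involutive m c)
  ... | no m≢i = inj₂ (double-flip-corner∈S₆ b m i m≢i)

S₆-2-forcing : IsLForcing (Q 3) 2 S₆
S₆-2-forcing L _ |L|≤2 v with corner-or-S₆ v
... | inj₁ (b , refl) = corner-forced |L|≤2 b
... | inj₂ v∈S₆ = initial v∈S₆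

2-forcing⇒6≤length : ∀ S → IsLForcing (Q 3) 2 S → 6 ≤ length S
2-forcing⇒6≤length S forcing with 6 ≤? length S
... | yes 6≤|S| = 6≤|S|
... | no 6≰|S| =
  ⊥-elim (double-flip-blocks (small-sets-miss-double-flip (s≤s (s≤s (≰⇒> 6≰|S|)))) forcing)

proposition20 : Zℓ≡ (Q 3) 2 6
proposition20 = (S₆ , S₆-unique , refl , S₆-2-forcing) , λ S _ → 2-forcing⇒6≤length S
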